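{- For each $n\ge 3$ there is a tight irreducible subcube partition of $\{0,1\}^n$ whose weight vector is $(1,n-1,n-1,0,\dots,0)$.
   Context: Subcubes of $\{0,1\}^n$ are identified with words in $\{0,1,*\}^n$. A subcube partition of length $n$ is a partition of $\{0,1\}^n$ into subcubes. It is irreducible if no subset $G$ with $1<|G|<|F|$ has a union that is a subcube; tight if every coordinate $i$ has some subcube $s$ with $s_i\ne*$. The weight of a subcube is the number of $1$s in its word. The weight vector of $F$ is $(w_0,\dots,w_n)$ where $w_h$ is the number of subcubes of $F$ of weight $h$. -}

module Defs where

open import Data.Nat using (ℕ; zero; suc; _<_; _≟_)
open import Data.Bool using (Bool; true; false)
open import Data.Fin using (Fin)
open import Data.Fin.Subset using (Subset; _∈_; ∣_∣)
open import Data.Vec using (Vec; []; _∷_; lookup)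
open import Data.List using (List; length; filter)
import Data.List as L
open import Data.Product using (Σ; ∃; _×_)
open import Relation.Binary.PropositionalEquality using (_≡_; _≢_)
open import Relation.Nullary using (¬_)
open import Function.Bundles using (_⇔_)

data Sym : Set where
  𝟘 𝟙 ⋆ : Sym

-- a subcube of {0,1}^n, identified with its word in {0,1,*}^n
Subcube : ℕ → Set
Subcube n = Vec Sym n

Point : ℕ → Set
Point n = Vec Bool n

data _∈ₛ_ : Bool → Sym → Set where
  f∈0 : false ∈ₛ 𝟘
  t∈1 : true ∈ₛ 𝟙
  b∈⋆ : ∀ {b} → b ∈ₛ ⋆

data _∈ᶜ_ : ∀ {n} → Point n → Subcube n → Set where
  []  : [] ∈ᶜ []
  _∷_ : ∀ {n b c} {x : Point n} {s : Subcube n} →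
        b ∈ₛ c → x ∈ᶜ s → (b ∷ x) ∈ᶜ (c ∷ s)

Family : ℕ → Set
Family n = List (Subcube n)

_!_ : ∀ {n} (F : Family n) → Fin (length F) → Subcube n
F ! i = L.lookup F i

IsSubcubePartition : ∀ {n} → Family n → Set
IsSubcubePartition {n} F =
  (x : Point n) →
    (∃ λ i → x ∈ᶜ (F ! i)) ×
    (∀ i j → x ∈ᶜ (F ! i) → x ∈ᶜ (F ! j) → i ≡ j)

UnionIs : ∀ {n} (F : Family n) → Subset (length F) → Subcube n → Set
UnionIs {n} F G s =
  (x : Point n) → (x ∈ᶜ s) ⇔ (∃ λ i → (i ∈ G) × (x ∈ᶜ (F ! i)))

Irreducible : ∀ {n} → Family n → Set
Irreducible {n} F =
  (G : Subset (length F)) → 1 < ∣ G ∣ → ∣ G ∣ < length F →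
    ¬ (∃ λ (s : Subcube n) → UnionIs F G s)

Tight : ∀ {n} → Family n → Set
Tight {n} F = (k : Fin n) → ∃ λ i → lookup (F ! i) k ≢ ⋆

weight : ∀ {n} → Subcube n → ℕ
weight [] = 0
weight (𝟙 ∷ s) = suc (weight s)
weight (𝟘 ∷ s) = weight s
weight (⋆ ∷ s) = weight s

weightCount : ∀ {n} → Family n → ℕ → ℕ
weightCount F h = length (filter (λ s → weight s ≟ h) F)

-- In dimension k + 2 the partition consists of the cylinder T = ⋆ᵏ11 together
-- with, for every prefix position j, the two cubes 0ʲ1⋆⋯⋆0 and 0ʲ1⋆⋯01, and the
-- two cubes 0ᵏ0⋆ and 0ᵏ10. Its 1-slice in the first coordinate is the
-- three-piece partition {⋆0, 01, 11} of the last two coordinates, and its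
-- 0-slice is the same construction one dimension lower, the two slices sharing T.
--
-- Call a subcube saturated if it is a union of members. By induction along the
-- recursion, every saturated subcube meeting two members is the whole cube.
-- Write such a subcube as a s, a its first letter. For a = 0, s is a saturated subcube
-- of the lower partition avoiding T. For a = 1, it would contain both 1-headed
-- members, hence by convexity a point of T, hence all of T, which has a ⋆ in
-- front. For a = ⋆, s is a union of pieces of {⋆0, 01, 11}, so it is one of
-- ⋆0, 01, 11, ⋆1 or everything (⋆0 ∪ 11 is not a subcube, 01 lying between
-- 00 and 11). The case 11 gives T alone. So the induction hypothesis must say:
-- in the lower partition no saturated subcube avoiding T meets two members,
-- and the cylinders over ⋆0, 01 and ⋆1 are not saturated.
module Submission where

open import Defs
open import Data.Nat using (ℕ; _≤_; _∸_)
open import Data.Product using (∃; _×_)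
open import Relation.Binary.PropositionalEquality using (_≡_)

open import Data.Nat using (zero; suc; _<_; _+_; s≤s; _≟_)
open import Data.Bool using (Bool; true; false; if_then_else_)
open import Data.Empty using (⊥; ⊥-elim)
open import Data.Fin using (Fin; zero; suc)
open import Data.Fin.Subset using (Subset; inside; outside; ∣_∣; Nonempty)
  renaming (_∈_ to _∈ˢ_; _∉_ to _∉ˢ_)
import Data.Vec.Base as Vec
open import Data.Vec using ([]; _∷_; lookup)
open import Data.List using ([]; _∷_; map)
open import Data.List.Membership.Propositional using (_∈_; find)
open import Data.List.Membership.Propositional.Properties using (∈-map⁺; ∈-map⁻; ∈-lookup)
open import Data.List.Relation.Unary.Any as Any using (Any; here; there; index)
open import Data.List.Relation.Unary.Any.Properties as Anyₚ using (lookup-index)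
open import Data.List.Relation.Unary.All as All using (All; []; _∷_)
import Data.List.Relation.Unary.All.Properties as Allₚ
open import Data.List.Relation.Unary.AllPairs as AllPairs using (AllPairs; []; _∷_)
import Data.List.Relation.Unary.AllPairs.Properties as AllPairsₚ
open import Data.Product using (_,_; proj₂; ∃₂)
import Data.Product as Product
open import Data.Sum using (_⊎_; inj₁; inj₂; [_,_]′)
import Data.Sum as Sum
open import Function.Bundles using (Equivalence)
open import Relation.Binary.PropositionalEquality using (_≢_; refl; sym; trans; cong; subst)
open import Relation.Nullary using (¬_; Dec; yes; no; does)
open import Relation.Nullary.Decidable using (map′; _×-dec_)

private
  variable
    n k : ℕ
    a c d : Sym
    b : Bool
    x y z : Point n
    s s′ C D : Subcube n
    F G : Family n

_∈ₛ?_ : (b : Bool) (c : Sym) → Dec (b ∈ₛ c)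
false ∈ₛ? 𝟘 = yes f∈0
true  ∈ₛ? 𝟘 = no λ ()
false ∈ₛ? 𝟙 = no λ ()
true  ∈ₛ? 𝟙 = yes t∈1
_     ∈ₛ? ⋆ = yes b∈⋆

_∈ᶜ?_ : (x : Point n) (s : Subcube n) → Dec (x ∈ᶜ s)
[]      ∈ᶜ? []      = yes []
(b ∷ x) ∈ᶜ? (c ∷ s) =
  map′ (Product.uncurry _∷_) (λ { (p ∷ q) → p , q }) (b ∈ₛ? c ×-dec x ∈ᶜ? s)

true∉𝟘 : ¬ true ∈ₛ 𝟘
true∉𝟘 ()

false∉𝟙 : ¬ false ∈ₛ 𝟙
false∉𝟙 ()

∈ᶜ-tail : (b ∷ x) ∈ᶜ (c ∷ s) → x ∈ᶜ s
∈ᶜ-tail (_ ∷ x∈s) = x∈s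

point : (s : Subcube n) → ∃ (_∈ᶜ s)
point []      = [] , []
point (𝟘 ∷ s) = Product.map (false ∷_) (f∈0 ∷_) (point s)
point (𝟙 ∷ s) = Product.map (true ∷_) (t∈1 ∷_) (point s)
point (⋆ ∷ s) = Product.map (false ∷_) (b∈⋆ ∷_) (point s)

data Between : Point n → Point n → Point n → Set where
  []    : Between [] [] []
  left  : ∀ {b b′} → Between x y z → Between (b ∷ x) (b′ ∷ y) (b ∷ z)
  right : ∀ {b b′} → Between x y z → Between (b ∷ x) (b′ ∷ y) (b′ ∷ z)

∈ᶜ-convex : x ∈ᶜ s → y ∈ᶜ s → Between x y z → z ∈ᶜ s
∈ᶜ-convex []        []        []        = []
∈ᶜ-convex (p ∷ x∈s) (_ ∷ y∈s) (left r)  = p ∷ ∈ᶜ-convex x∈s y∈s r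
∈ᶜ-convex (_ ∷ x∈s) (q ∷ y∈s) (right r) = q ∷ ∈ᶜ-convex x∈s y∈s r

_⊆ᶜ_ : Subcube n → Subcube n → Set
s ⊆ᶜ s′ = ∀ {x} → x ∈ᶜ s → x ∈ᶜ s′

_≐ᶜ_ : Subcube n → Subcube n → Set
s ≐ᶜ s′ = s ⊆ᶜ s′ × s′ ⊆ᶜ s

Disjointᶜ : Subcube n → Subcube n → Set
Disjointᶜ s s′ = ∀ {x} → x ∈ᶜ s → x ∈ᶜ s′ → ⊥

∷-disjoint : Disjointᶜ s s′ → Disjointᶜ (c ∷ s) (d ∷ s′)
∷-disjoint s#s′ (_ ∷ p) (_ ∷ q) = s#s′ p q

Meets : Subcube n → Subcube n → Set
Meets s s′ = ∃ λ x → x ∈ᶜ s × x ∈ᶜ s′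

Full : Subcube n → Set
Full s = ∀ x → x ∈ᶜ s

disjoint-elim : {A : Set} → Disjointᶜ s s′ → x ∈ᶜ s → x ∈ᶜ s′ → A
disjoint-elim s#s′ x∈s x∈s′ = ⊥-elim (s#s′ x∈s x∈s′)

witness-≢ : x ∈ᶜ s → ¬ x ∈ᶜ s′ → s ≢ s′
witness-≢ x∈s x∉s′ refl = x∉s′ x∈s

Covers : Family n → Set
Covers F = ∀ x → Any (x ∈ᶜ_) F

-- For a partition these are exactly the unions of subfamilies.
Saturated : Family n → Subcube n → Set
Saturated F s = ∀ {C} → C ∈ F → Meets C s → C ⊆ᶜ s

Indecomposable : Family n → Set
Indecomposable F = ∀ {s C D} → Saturated F s → C ∈ F → D ∈ F → C ≢ D →
  Meets C s → Meets D s → Full s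

saturated-≐ : s ≐ᶜ s′ → Saturated F s → Saturated F s′
saturated-≐ (s⊆s′ , s′⊆s) sat C∈F (x , x∈C , x∈s′) y∈C =
  s⊆s′ (sat C∈F (x , x∈C , s′⊆s x∈s′) y∈C)

⊆-or-disjoint : Saturated F s → C ∈ F → x ∈ᶜ C → Dec (x ∈ᶜ s) → C ⊆ᶜ s ⊎ Disjointᶜ C s
⊆-or-disjoint sat C∈F x∈C (yes x∈s) = inj₁ (sat C∈F (_ , x∈C , x∈s))
⊆-or-disjoint sat C∈F x∈C (no x∉s)  = inj₂ λ y∈C y∈s → x∉s (sat C∈F (_ , y∈C , y∈s) x∈C)

⋆-member-meets⇒⋆ : Saturated F (a ∷ s) → (⋆ ∷ C) ∈ F → Meets (⋆ ∷ C) (a ∷ s) → ∀ b → b ∈ₛ a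
⋆-member-meets⇒⋆ sat C∈F meets@(_ , _ ∷ y∈C , _) b with sat C∈F meets (b∈⋆ {b} ∷ y∈C)
... | b∈a ∷ _ = b∈a

Extends : Bool → Family n → Family (suc n) → Set
Extends b G F = ∀ {c} → c ∈ G → ∃ λ C → C ∈ F × ∀ {y} → y ∈ᶜ c → (b ∷ y) ∈ᶜ C

saturated-slice : Extends b G F → b ∈ₛ a → Saturated F (a ∷ s) → Saturated G s
saturated-slice extends b∈a sat c∈G (x , x∈c , x∈s) y∈c with extends c∈G
... | C , C∈F , c⊆C = ∈ᶜ-tail (sat C∈F (_ , c⊆C x∈c , b∈a ∷ x∈s) (c⊆C y∈c))

index-unique : AllPairs Disjointᶜ F → ∀ i j → x ∈ᶜ (F ! i) → x ∈ᶜ (F ! j) → i ≡ j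
index-unique (_ ∷ _)      zero    zero    _ _ = refl
index-unique (C# ∷ _)     zero    (suc j) p q = ⊥-elim (All.lookup C# (∈-lookup j) p q)
index-unique (C# ∷ _)     (suc i) zero    p q = ⊥-elim (All.lookup C# (∈-lookup i) q p)
index-unique (_ ∷ rest#) (suc i) (suc j) p q = cong suc (index-unique rest# i j p q)

partition : Covers F → AllPairs Disjointᶜ F → IsSubcubePartition F
partition cover disjoint x = (index (cover x) , lookup-index (cover x)) , index-unique disjoint

member-unique : IsSubcubePartition F → C ∈ F → D ∈ F → x ∈ᶜ C → x ∈ᶜ D → C ≡ D
member-unique {F = F} {x = x} part C∈F D∈F x∈C x∈D =
  trans (lookup-index C∈F) (trans (cong (F !_) same-index) (sym (lookup-index D∈F)))
  where
  same-index : index C∈F ≡ index D∈F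
  same-index = proj₂ (part x) _ _
    (subst (x ∈ᶜ_) (lookup-index C∈F) x∈C) (subst (x ∈ᶜ_) (lookup-index D∈F) x∈D)

tight : (∀ j → Any (λ C → lookup C j ≢ ⋆) F) → Tight F
tight fixes j = index (fixes j) , lookup-index (fixes j)

-- From indecomposability to irreducibility

nonempty : {p : Subset n} → 0 < ∣ p ∣ → Nonempty p
nonempty {p = inside ∷ p}  _     = zero , Vec.here
nonempty {p = outside ∷ p} 0<∣p∣ = Product.map suc Vec.there (nonempty 0<∣p∣)

two-members : {p : Subset n} → 1 < ∣ p ∣ → ∃₂ λ i j → i ∈ˢ p × j ∈ˢ p × i ≢ j
two-members {p = inside ∷ p} (s≤s 0<∣p∣) with nonempty 0<∣p∣
... | j , j∈p = zero , suc j , Vec.here , Vec.there j∈p , λ ()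
two-members {p = outside ∷ p} 1<∣p∣ with two-members 1<∣p∣
... | i , j , i∈p , j∈p , i≢j =
  suc i , suc j , Vec.there i∈p , Vec.there j∈p , λ { refl → i≢j refl }

non-member : {p : Subset n} → ∣ p ∣ < n → ∃ λ i → i ∉ˢ p
non-member {p = outside ∷ p} _            = zero , λ ()
non-member {p = inside ∷ p}  (s≤s ∣p∣<n) with non-member ∣p∣<n
... | i , i∉p = suc i , λ { (Vec.there i∈p) → i∉p i∈p }

indecomposable⇒irreducible : IsSubcubePartition F → Indecomposable F → Irreducible F
indecomposable⇒irreducible {F = F} part indecomposable G 1<∣G∣ ∣G∣<∣F∣ (s , union)
  with two-members 1<∣G∣ | non-member ∣G∣<∣F∣
... | i , j , i∈G , j∈G , i≢j | e , e∉G = e∉G e∈G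
  where
  open Equivalence

  saturated : Saturated F s
  saturated C∈F (x , x∈C , x∈s) {y} y∈C with to (union x) x∈s
  ... | l , l∈G , x∈Fl = from (union y)
    (l , l∈G , subst (y ∈ᶜ_) (member-unique part C∈F (∈-lookup l) x∈C x∈Fl) y∈C)

  meets : ∀ {l} → l ∈ˢ G → Meets (F ! l) s
  meets {l} l∈G with point (F ! l)
  ... | x , x∈Fl = x , x∈Fl , from (union x) (l , l∈G , x∈Fl)

  distinct : F ! i ≢ F ! j
  distinct eq with point (F ! i)
  ... | x , x∈Fi = i≢j (proj₂ (part x) i j x∈Fi (subst (x ∈ᶜ_) eq x∈Fi))

  full : Full s
  full = indecomposable saturated (∈-lookup i) (∈-lookup j) distinct (meets i∈G) (meets j∈G)

  e∈G : e ∈ˢ G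
  e∈G with point (F ! e)
  ... | x , x∈Fe with to (union x) (full x)
  ...   | l , l∈G , x∈Fl = subst (_∈ˢ G) (proj₂ (part x) l e x∈Fl x∈Fe) l∈G

cylinder : Sym → Sym → (k : ℕ) → Subcube (2 + k)
cylinder c d zero    = c ∷ d ∷ []
cylinder c d (suc k) = ⋆ ∷ cylinder c d k

corner : Bool → Bool → (k : ℕ) → Point (2 + k)
corner b b′ zero    = b ∷ b′ ∷ []
corner b b′ (suc k) = false ∷ corner b b′ k

corner∈cylinder : ∀ {b b′} → b ∈ₛ c → b′ ∈ₛ d → corner b b′ k ∈ᶜ cylinder c d k
corner∈cylinder {k = zero}  p q = p ∷ q ∷ []
corner∈cylinder {k = suc k} p q = b∈⋆ ∷ corner∈cylinder p q

corner-between : ∀ {b₁ b₁′ b₂ b₂′ b₃ b₃′} →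
  Between (b₁ ∷ b₁′ ∷ []) (b₂ ∷ b₂′ ∷ []) (b₃ ∷ b₃′ ∷ []) →
  Between (corner b₁ b₁′ k) (corner b₂ b₂′ k) (corner b₃ b₃′ k)
corner-between {k = zero}  r = r
corner-between {k = suc k} r = left (corner-between r)

cylinder-disjoint : ∀ {c′ d′} → Disjointᶜ (c ∷ d ∷ []) (c′ ∷ d′ ∷ []) →
  Disjointᶜ (cylinder c d k) (cylinder c′ d′ k)
cylinder-disjoint {k = zero}  cd#c′d′ = cd#c′d′
cylinder-disjoint {k = suc k} cd#c′d′ = ∷-disjoint (cylinder-disjoint cd#c′d′)

cylinder-⊆ : ∀ {c′ d′} → (c ∷ d ∷ []) ⊆ᶜ (c′ ∷ d′ ∷ []) → cylinder c d k ⊆ᶜ cylinder c′ d′ k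
cylinder-⊆ {k = zero}  cd⊆c′d′ = cd⊆c′d′
cylinder-⊆ {k = suc k} cd⊆c′d′ (_ ∷ p) = b∈⋆ ∷ cylinder-⊆ cd⊆c′d′ p

u v t w : (k : ℕ) → Subcube (2 + k)
u = cylinder ⋆ 𝟘
v = cylinder 𝟘 𝟙
t = cylinder 𝟙 𝟙
w = cylinder ⋆ 𝟙

u#v : Disjointᶜ (u k) (v k)
u#v = cylinder-disjoint λ { (_ ∷ f∈0 ∷ []) (_ ∷ () ∷ []) }

u#t : Disjointᶜ (u k) (t k)
u#t = cylinder-disjoint λ { (_ ∷ f∈0 ∷ []) (_ ∷ () ∷ []) }

v#t : Disjointᶜ (v k) (t k)
v#t = cylinder-disjoint λ { (f∈0 ∷ _) (() ∷ _) }

u#w : Disjointᶜ (u k) (w k)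
u#w = cylinder-disjoint λ { (_ ∷ f∈0 ∷ []) (_ ∷ () ∷ []) }

v⊆w : v k ⊆ᶜ w k
v⊆w = cylinder-⊆ λ { (_ ∷ t∈1 ∷ []) → b∈⋆ ∷ t∈1 ∷ [] }

t⊆w : t k ⊆ᶜ w k
t⊆w = cylinder-⊆ λ { (_ ∷ t∈1 ∷ []) → b∈⋆ ∷ t∈1 ∷ [] }

-- The three-piece partition {⋆0, 01, 11}

tripartition : (k : ℕ) → Family (2 + k)
tripartition k = u k ∷ v k ∷ t k ∷ []

tripartition-cover : ∀ k (x : Point (2 + k)) → x ∈ᶜ u k ⊎ x ∈ᶜ v k ⊎ x ∈ᶜ t k
tripartition-cover zero    (_ ∷ false ∷ [])     = inj₁ (b∈⋆ ∷ f∈0 ∷ [])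
tripartition-cover zero    (false ∷ true ∷ [])  = inj₂ (inj₁ (f∈0 ∷ t∈1 ∷ []))
tripartition-cover zero    (true ∷ true ∷ [])   = inj₂ (inj₂ (t∈1 ∷ t∈1 ∷ []))
tripartition-cover (suc k) (_ ∷ x) =
  Sum.map (b∈⋆ ∷_) (Sum.map (b∈⋆ ∷_) (b∈⋆ ∷_)) (tripartition-cover k x)

tripartition-⊆ :
  (∀ {y} → y ∈ᶜ u k → y ∈ᶜ s → y ∈ᶜ s′) → (∀ {y} → y ∈ᶜ v k → y ∈ᶜ s → y ∈ᶜ s′) →
  (∀ {y} → y ∈ᶜ t k → y ∈ᶜ s → y ∈ᶜ s′) → s ⊆ᶜ s′
tripartition-⊆ {k = k} on-u on-v on-t y∈s =
  [ (λ y∈u → on-u y∈u y∈s) , [ (λ y∈v → on-v y∈v y∈s) , (λ y∈t → on-t y∈t y∈s) ]′ ]′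
    (tripartition-cover k _)

tripartition-saturated : Saturated (tripartition k) s → x ∈ᶜ s →
  s ≐ᶜ u k ⊎ s ≐ᶜ v k ⊎ s ≐ᶜ t k ⊎ s ≐ᶜ w k ⊎ Full s
tripartition-saturated {k = k} {s = s} {x = x} sat x∈s
  with ⊆-or-disjoint sat (here refl) (corner∈cylinder {k = k} (b∈⋆ {true}) f∈0) (_ ∈ᶜ? s)
     | ⊆-or-disjoint sat (there (here refl)) (corner∈cylinder {k = k} f∈0 t∈1) (_ ∈ᶜ? s)
     | ⊆-or-disjoint sat (there (there (here refl))) (corner∈cylinder {k = k} t∈1 t∈1) (_ ∈ᶜ? s)
... | inj₂ u#s | inj₂ v#s | inj₂ t#s =
  ⊥-elim ([ (λ x∈u → u#s x∈u x∈s) , [ (λ x∈v → v#s x∈v x∈s) , (λ x∈t → t#s x∈t x∈s) ]′ ]′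
    (tripartition-cover k x))
... | inj₁ u⊆s | inj₂ v#s | inj₂ t#s =
  inj₁ (tripartition-⊆ (λ y∈u _ → y∈u) (disjoint-elim v#s) (disjoint-elim t#s) , u⊆s)
... | inj₂ u#s | inj₁ v⊆s | inj₂ t#s =
  inj₂ (inj₁ (tripartition-⊆ (disjoint-elim u#s) (λ y∈v _ → y∈v) (disjoint-elim t#s) , v⊆s))
... | inj₂ u#s | inj₂ v#s | inj₁ t⊆s =
  inj₂ (inj₂ (inj₁ (tripartition-⊆ (disjoint-elim u#s) (disjoint-elim v#s) (λ y∈t _ → y∈t) , t⊆s)))
... | inj₂ u#s | inj₁ v⊆s | inj₁ t⊆s =
  inj₂ (inj₂ (inj₂ (inj₁
    ( tripartition-⊆ (disjoint-elim u#s) (λ y∈v _ → v⊆w y∈v) (λ y∈t _ → t⊆w y∈t)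
    , tripartition-⊆ (disjoint-elim u#w) (λ y∈v _ → v⊆s y∈v) (λ y∈t _ → t⊆s y∈t)))))
... | inj₁ u⊆s | inj₁ v⊆s | inj₁ t⊆s =
  inj₂ (inj₂ (inj₂ (inj₂ λ y → [ u⊆s , [ v⊆s , t⊆s ]′ ]′ (tripartition-cover k y))))
... | inj₁ u⊆s | inj₁ v⊆s | inj₂ t#s =
  ⊥-elim (t#s (corner∈cylinder t∈1 t∈1)
    (∈ᶜ-convex (u⊆s (corner∈cylinder (b∈⋆ {true}) f∈0)) (v⊆s (corner∈cylinder f∈0 t∈1))
      (corner-between (left (right [])))))
... | inj₁ u⊆s | inj₂ v#s | inj₁ t⊆s =
  ⊥-elim (v#s (corner∈cylinder f∈0 t∈1)
    (∈ᶜ-convex (u⊆s (corner∈cylinder (b∈⋆ {false}) f∈0)) (t⊆s (corner∈cylinder t∈1 t∈1))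
      (corner-between (left (right [])))))

-- The partition

rest : (k : ℕ) → Family (2 + k)
rest zero    = (𝟘 ∷ ⋆ ∷ []) ∷ (𝟙 ∷ 𝟘 ∷ []) ∷ []
rest (suc k) = (𝟙 ∷ u k) ∷ (𝟙 ∷ v k) ∷ map (𝟘 ∷_) (rest k)

family : (k : ℕ) → Family (2 + k)
family k = t k ∷ rest k

data Member (k : ℕ) : Subcube (3 + k) → Set where
  top    : Member k (⋆ ∷ t k)
  one-u  : Member k (𝟙 ∷ u k)
  one-v  : Member k (𝟙 ∷ v k)
  zero-∷ : ∀ {c} → c ∈ rest k → Member k (𝟘 ∷ c)

member : C ∈ family (suc k) → Member k C
member (here refl)                 = top
member (there (here refl))         = one-u
member (there (there (here refl))) = one-v
member (there (there (there C∈))) with ∈-map⁻ (𝟘 ∷_) C∈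
... | _ , c∈ , refl = zero-∷ c∈

zero-∷∈family : ∀ {c} → c ∈ rest k → (𝟘 ∷ c) ∈ family (suc k)
zero-∷∈family c∈ = there (there (there (∈-map⁺ (𝟘 ∷_) c∈)))

family-covers : ∀ k → Covers (family k)
family-covers zero (false ∷ _ ∷ [])    = there (here (f∈0 ∷ b∈⋆ ∷ []))
family-covers zero (true ∷ false ∷ []) = there (there (here (t∈1 ∷ f∈0 ∷ [])))
family-covers zero (true ∷ true ∷ [])  = here (t∈1 ∷ t∈1 ∷ [])
family-covers (suc k) (false ∷ x) with family-covers k x
... | here x∈t     = here (b∈⋆ ∷ x∈t)
... | there x∈rest = there (there (there (Anyₚ.map⁺ (Any.map (f∈0 ∷_) x∈rest))))
family-covers (suc k) (true ∷ x) with tripartition-cover k x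
... | inj₁ x∈u        = there (here (t∈1 ∷ x∈u))
... | inj₂ (inj₁ x∈v) = there (there (here (t∈1 ∷ x∈v)))
... | inj₂ (inj₂ x∈t) = here (b∈⋆ ∷ x∈t)

family-disjoint : ∀ k → AllPairs Disjointᶜ (family k)
family-disjoint zero =
  ( (λ { (t∈1 ∷ _) (() ∷ _) }) ∷ (λ { (_ ∷ t∈1 ∷ []) (_ ∷ () ∷ []) }) ∷ [] )
  ∷ ((λ { (f∈0 ∷ _) (() ∷ _) }) ∷ []) ∷ [] ∷ []
family-disjoint (suc k) with family-disjoint k
... | t#rest ∷ rest# =
  (∷-disjoint (λ p q → u#t q p) ∷ ∷-disjoint (λ p q → v#t q p)
     ∷ Allₚ.map⁺ (All.map ∷-disjoint t#rest))
  ∷ (∷-disjoint u#v ∷ Allₚ.map⁺ (All.tabulate λ _ → λ { (t∈1 ∷ _) (() ∷ _) }))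
  ∷ Allₚ.map⁺ (All.tabulate λ _ → λ { (t∈1 ∷ _) (() ∷ _) })
  ∷ AllPairsₚ.map⁺ (AllPairs.map ∷-disjoint rest#)

family-partition : ∀ k → IsSubcubePartition (family k)
family-partition k = partition (family-covers k) (family-disjoint k)

family-fixes : ∀ k (j : Fin (2 + k)) → Any (λ C → lookup C j ≢ ⋆) (family k)
family-fixes zero    zero       = there (here λ ())
family-fixes zero    (suc zero) = here λ ()
family-fixes (suc k) zero       = there (here λ ())
family-fixes (suc k) (suc j) with family-fixes k j
... | here fixed  = here fixed
... | there fixed = there (there (there (Anyₚ.map⁺ fixed)))

family-extends-false : Extends false (family k) (family (suc k))
family-extends-false (here refl) = _ , here refl , b∈⋆ ∷_
family-extends-false (there c∈)  = _ , zero-∷∈family c∈ , f∈0 ∷_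

tripartition-extends-true : Extends true (tripartition k) (family (suc k))
tripartition-extends-true (here refl)                 = _ , there (here refl) , t∈1 ∷_
tripartition-extends-true (there (here refl))         = _ , there (there (here refl)) , t∈1 ∷_
tripartition-extends-true (there (there (here refl))) = _ , here refl , b∈⋆ ∷_

zero-slice-meets : Saturated (family (suc k)) (𝟘 ∷ s) → C ∈ family (suc k) →
  Meets C (𝟘 ∷ s) → ∃ λ c → c ∈ rest k × C ≡ 𝟘 ∷ c × Meets c s
zero-slice-meets sat C∈ meets with member C∈ | meets
... | top       | _                      = ⊥-elim (true∉𝟘 (⋆-member-meets⇒⋆ sat C∈ meets true))
... | one-u     | _ , t∈1 ∷ _ , () ∷ _
... | one-v     | _ , t∈1 ∷ _ , () ∷ _
... | zero-∷ c∈ | _ , _ ∷ y∈c , _ ∷ y∈s = _ , c∈ , refl , _ , y∈c , y∈s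

zero-slice-avoids-t : Saturated (family (suc k)) (𝟘 ∷ s) → ¬ Meets (t k) s
zero-slice-avoids-t sat (_ , y∈t , y∈s) =
  true∉𝟘 (⋆-member-meets⇒⋆ sat (here refl) (_ , b∈⋆ ∷ y∈t , f∈0 ∷ y∈s) true)

one-slice-meets : Saturated (family (suc k)) (𝟙 ∷ s) → C ∈ family (suc k) → Meets C (𝟙 ∷ s) →
  C ≡ 𝟙 ∷ u k × Meets (u k) s ⊎ C ≡ 𝟙 ∷ v k × Meets (v k) s
one-slice-meets sat C∈ meets with member C∈ | meets
... | top      | _                      = ⊥-elim (false∉𝟙 (⋆-member-meets⇒⋆ sat C∈ meets false))
... | one-u    | _ , _ ∷ y∈u , _ ∷ y∈s = inj₁ (refl , _ , y∈u , y∈s)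
... | one-v    | _ , _ ∷ y∈v , _ ∷ y∈s = inj₂ (refl , _ , y∈v , y∈s)
... | zero-∷ _ | _ , f∈0 ∷ _ , () ∷ _

-- The corners of u and v span the corner of t.
one-slice-meets-u-v : Saturated (family (suc k)) (𝟙 ∷ s) → Meets (u k) s → Meets (v k) s → ⊥
one-slice-meets-u-v sat u-meets v-meets =
  false∉𝟙 (⋆-member-meets⇒⋆ sat (here refl) (_ , b∈⋆ ∷ corner∈cylinder t∈1 t∈1 , t∈1 ∷ t-corner∈s) false)
  where
  sat₁ = saturated-slice tripartition-extends-true t∈1 sat
  t-corner∈s = ∈ᶜ-convex
    (sat₁ (here refl) u-meets (corner∈cylinder (b∈⋆ {true}) f∈0))
    (sat₁ (there (here refl)) v-meets (corner∈cylinder f∈0 t∈1))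
    (corner-between (left (right [])))

one-slice : Saturated (family (suc k)) (𝟙 ∷ s) → C ∈ family (suc k) → D ∈ family (suc k) →
  C ≢ D → Meets C (𝟙 ∷ s) → Meets D (𝟙 ∷ s) → ⊥
one-slice sat C∈ D∈ C≢D C-meets D-meets
  with one-slice-meets sat C∈ C-meets | one-slice-meets sat D∈ D-meets
... | inj₁ (refl , _)    | inj₁ (refl , _)    = C≢D refl
... | inj₂ (refl , _)    | inj₂ (refl , _)    = C≢D refl
... | inj₁ (_ , u-meets) | inj₂ (_ , v-meets) = one-slice-meets-u-v sat u-meets v-meets
... | inj₂ (_ , v-meets) | inj₁ (_ , u-meets) = one-slice-meets-u-v sat u-meets v-meets

record Invariant (k : ℕ) : Set where
  field
    off-t-unique : Saturated (family k) s → ¬ Meets (t k) s →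
      C ∈ family k → D ∈ family k → C ≢ D → Meets C s → Meets D s → ⊥
    u-unsaturated : ¬ Saturated (family k) (u k)
    v-unsaturated : ¬ Saturated (family k) (v k)
    w-unsaturated : ¬ Saturated (family k) (w k)

open Invariant

zero-slice : Invariant k → Saturated (family (suc k)) (𝟘 ∷ s) →
  C ∈ family (suc k) → D ∈ family (suc k) → C ≢ D → Meets C (𝟘 ∷ s) → Meets D (𝟘 ∷ s) → ⊥
zero-slice inv sat C∈ D∈ C≢D C-meets D-meets
  with zero-slice-meets sat C∈ C-meets | zero-slice-meets sat D∈ D-meets
... | _ , c∈ , refl , c-meets | _ , d∈ , refl , d-meets =
  off-t-unique inv (saturated-slice family-extends-false f∈0 sat) (zero-slice-avoids-t sat)
    (there c∈) (there d∈) (λ c≡d → C≢D (cong (𝟘 ∷_) c≡d)) c-meets d-meets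

star-slice : Invariant k → Saturated (family (suc k)) (⋆ ∷ s) →
  C ∈ family (suc k) → D ∈ family (suc k) → C ≢ D → Meets C (⋆ ∷ s) → Meets D (⋆ ∷ s) →
  Full (⋆ ∷ s)
star-slice {k = k} {s = s} inv sat C∈ D∈ C≢D C-meets@(_ , _ , _ ∷ y∈s) D-meets =
  classify (tripartition-saturated (saturated-slice tripartition-extends-true b∈⋆ sat) y∈s)
  where
  sat₀ : Saturated (family k) s
  sat₀ = saturated-slice family-extends-false b∈⋆ sat

  is-top : s ⊆ᶜ t k → C ∈ family (suc k) → Meets C (⋆ ∷ s) → C ≡ ⋆ ∷ t k
  is-top s⊆t C∈ (_ , x∈C , _ ∷ y∈s) =
    member-unique (family-partition (suc k)) C∈ (here refl) x∈C (b∈⋆ ∷ s⊆t y∈s)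

  classify : s ≐ᶜ u k ⊎ s ≐ᶜ v k ⊎ s ≐ᶜ t k ⊎ s ≐ᶜ w k ⊎ Full s → Full (⋆ ∷ s)
  classify (inj₁ s≐u)                      = ⊥-elim (u-unsaturated inv (saturated-≐ s≐u sat₀))
  classify (inj₂ (inj₁ s≐v))               = ⊥-elim (v-unsaturated inv (saturated-≐ s≐v sat₀))
  classify (inj₂ (inj₂ (inj₁ (s⊆t , _)))) =
    ⊥-elim (C≢D (trans (is-top s⊆t C∈ C-meets) (sym (is-top s⊆t D∈ D-meets))))
  classify (inj₂ (inj₂ (inj₂ (inj₁ s≐w)))) = ⊥-elim (w-unsaturated inv (saturated-≐ s≐w sat₀))
  classify (inj₂ (inj₂ (inj₂ (inj₂ full)))) (_ ∷ x) = b∈⋆ ∷ full x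

family-indecomposable : Invariant k → Indecomposable (family (suc k))
family-indecomposable inv {𝟘 ∷ s} sat C∈ D∈ C≢D C-meets D-meets =
  ⊥-elim (zero-slice inv sat C∈ D∈ C≢D C-meets D-meets)
family-indecomposable inv {𝟙 ∷ s} sat C∈ D∈ C≢D C-meets D-meets =
  ⊥-elim (one-slice sat C∈ D∈ C≢D C-meets D-meets)
family-indecomposable inv {⋆ ∷ s} = star-slice inv

⋆-extension-unsaturated : Indecomposable F → Covers F →
  (𝟙 ∷ s) ∈ F → y ∈ᶜ s → ¬ Full (⋆ ∷ s) → ¬ Saturated F (⋆ ∷ s)
⋆-extension-unsaturated {y = y} indecomposable cover C∈ y∈s partial sat
  with find (cover (false ∷ y))
... | D , D∈ , y∈D =
  partial (indecomposable sat D∈ C∈ (witness-≢ y∈D λ { (() ∷ _) })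
    (_ , y∈D , b∈⋆ ∷ y∈s) (_ , t∈1 ∷ y∈s , b∈⋆ ∷ y∈s))

invariant-suc : Indecomposable (family (suc k)) → Invariant (suc k)
invariant-suc {k = k} indecomposable = record
  { off-t-unique  = λ sat t-off C∈ D∈ C≢D C-meets D-meets →
      t-off (_ , corner∈cylinder t∈1 t∈1 , indecomposable sat C∈ D∈ C≢D C-meets D-meets _)
  ; u-unsaturated = ⋆-extension-unsaturated indecomposable (family-covers (suc k))
      (there (here refl)) u-corner (λ full → u#t (∈ᶜ-tail (full (corner true true (suc k)))) t-corner)
  ; v-unsaturated = ⋆-extension-unsaturated indecomposable (family-covers (suc k))
      (there (there (here refl))) v-corner (λ full → v#t (∈ᶜ-tail (full (corner true true (suc k)))) t-corner)
  ; w-unsaturated = λ sat → u#w u-corner (∈ᶜ-tail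
      (indecomposable sat (here refl) (there (there (here refl))) (λ ())
        (_ , b∈⋆ {true} ∷ t-corner , b∈⋆ ∷ t⊆w t-corner) (_ , t∈1 ∷ v-corner , b∈⋆ ∷ v⊆w v-corner)
        (corner true false (suc k))))
  }
  where
  u-corner = corner∈cylinder {k = k} (b∈⋆ {true}) f∈0
  v-corner = corner∈cylinder {k = k} f∈0 t∈1
  t-corner = corner∈cylinder {k = k} t∈1 t∈1

invariant-zero : Invariant zero
invariant-zero = record
  { off-t-unique  = off-t-unique₀
  ; u-unsaturated = column-unsaturated {b′ = true} (b∈⋆ ∷ f∈0 ∷ []) λ { (_ ∷ () ∷ []) }
  ; v-unsaturated = column-unsaturated {b′ = false} (f∈0 ∷ t∈1 ∷ []) λ { (_ ∷ () ∷ []) }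
  ; w-unsaturated = column-unsaturated {b′ = false} (b∈⋆ ∷ t∈1 ∷ []) λ { (_ ∷ () ∷ []) }
  }
  where
  column-unsaturated : ∀ {b b′} → (false ∷ b ∷ []) ∈ᶜ s → ¬ (false ∷ b′ ∷ []) ∈ᶜ s →
    ¬ Saturated (family zero) s
  column-unsaturated x∈s y∉s sat =
    y∉s (sat (there (here refl)) (_ , f∈0 ∷ b∈⋆ ∷ [] , x∈s) (f∈0 ∷ b∈⋆ ∷ []))

  -- 10 and 01 span 11.
  meets-t : Saturated (family zero) s →
    Meets (𝟘 ∷ ⋆ ∷ []) s → Meets (𝟙 ∷ 𝟘 ∷ []) s → Meets (t zero) s
  meets-t sat 0⋆-meets 10-meets = _ , t∈1 ∷ t∈1 ∷ [] , ∈ᶜ-convex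
    (sat (there (there (here refl))) 10-meets (t∈1 ∷ f∈0 ∷ []))
    (sat (there (here refl)) 0⋆-meets (f∈0 ∷ b∈⋆ ∷ []))
    (left (right []))

  off-t-unique₀ : Saturated (family zero) s → ¬ Meets (t zero) s →
    C ∈ family zero → D ∈ family zero → C ≢ D → Meets C s → Meets D s → ⊥
  off-t-unique₀ _   t-off (here refl) _           _   C-meets _       = t-off C-meets
  off-t-unique₀ _   t-off _           (here refl) _   _       D-meets = t-off D-meets
  off-t-unique₀ _   _     (there (here refl)) (there (here refl)) C≢D _ _ = C≢D refl
  off-t-unique₀ _   _     (there (there (here refl))) (there (there (here refl))) C≢D _ _ = C≢D refl
  off-t-unique₀ sat t-off (there (here refl)) (there (there (here refl))) _ C-meets D-meets =
    t-off (meets-t sat C-meets D-meets)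
  off-t-unique₀ sat t-off (there (there (here refl))) (there (here refl)) _ C-meets D-meets =
    t-off (meets-t sat D-meets C-meets)

invariant : ∀ k → Invariant k
invariant zero    = invariant-zero
invariant (suc k) = invariant-suc (family-indecomposable (invariant k))

family-irreducible : ∀ k → Irreducible (family (suc k))
family-irreducible k =
  indecomposable⇒irreducible (family-partition (suc k)) (family-indecomposable (invariant k))

-- Weights

δ : ℕ → ℕ → ℕ
δ m h = if does (m ≟ h) then 1 else 0

weightCount-∷ : ∀ (C : Subcube n) F {m} h → weight C ≡ m →
  weightCount (C ∷ F) h ≡ δ m h + weightCount F h
weightCount-∷ C F h refl with does (weight C ≟ h)
... | true  = refl
... | false = refl

weightCount-map-𝟘∷ : ∀ (F : Family n) h → weightCount (map (𝟘 ∷_) F) h ≡ weightCount F h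
weightCount-map-𝟘∷ []      h = refl
weightCount-map-𝟘∷ (C ∷ F) h with does (weight C ≟ h)
... | true  = cong suc (weightCount-map-𝟘∷ F h)
... | false = weightCount-map-𝟘∷ F h

weight-cylinder : ∀ c d k → weight (cylinder c d k) ≡ weight (c ∷ d ∷ [])
weight-cylinder c d zero    = refl
weight-cylinder c d (suc k) = weight-cylinder c d k

weightCount-family : ∀ k h → weightCount (family k) h ≡ δ 2 h + weightCount (rest k) h
weightCount-family k h = weightCount-∷ (t k) (rest k) h (weight-cylinder 𝟙 𝟙 k)

weightCount-rest-suc : ∀ k h →
  weightCount (rest (suc k)) h ≡ δ 1 h + (δ 2 h + weightCount (rest k) h)
weightCount-rest-suc k h =
  trans (weightCount-∷ (𝟙 ∷ u k) _ h (cong suc (weight-cylinder ⋆ 𝟘 k))) (cong (δ 1 h +_)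
  (trans (weightCount-∷ (𝟙 ∷ v k) _ h (cong suc (weight-cylinder 𝟘 𝟙 k))) (cong (δ 2 h +_)
  (weightCount-map-𝟘∷ (rest k) h))))

weightCount-rest-0 : ∀ k → weightCount (rest k) 0 ≡ 1
weightCount-rest-0 zero    = refl
weightCount-rest-0 (suc k) = trans (weightCount-rest-suc k 0) (weightCount-rest-0 k)

weightCount-rest-1 : ∀ k → weightCount (rest k) 1 ≡ suc k
weightCount-rest-1 zero    = refl
weightCount-rest-1 (suc k) = trans (weightCount-rest-suc k 1) (cong suc (weightCount-rest-1 k))

weightCount-rest-2 : ∀ k → weightCount (rest k) 2 ≡ k
weightCount-rest-2 zero    = refl
weightCount-rest-2 (suc k) = trans (weightCount-rest-suc k 2) (cong suc (weightCount-rest-2 k))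

weightCount-rest-≥3 : ∀ k h → weightCount (rest k) (3 + h) ≡ 0
weightCount-rest-≥3 zero    h = refl
weightCount-rest-≥3 (suc k) h = trans (weightCount-rest-suc k (3 + h)) (weightCount-rest-≥3 k h)

theorem2p31 : (n : ℕ) → 3 ≤ n →
    ∃ λ (F : Family n) →
      IsSubcubePartition F × Tight F × Irreducible F ×
      weightCount F 0 ≡ 1 × weightCount F 1 ≡ n ∸ 1 × weightCount F 2 ≡ n ∸ 1 ×
      ((h : ℕ) → 3 ≤ h → h ≤ n → weightCount F h ≡ 0)
theorem2p31 (suc (suc (suc k))) (s≤s (s≤s (s≤s _))) =
  family (suc k) ,
  family-partition (suc k) ,
  tight (family-fixes (suc k)) ,
  family-irreducible k ,
  trans (weightCount-family (suc k) 0) (weightCount-rest-0 (suc k)) ,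
  trans (weightCount-family (suc k) 1) (weightCount-rest-1 (suc k)) ,
  trans (weightCount-family (suc k) 2) (cong suc (weightCount-rest-2 (suc k))) ,
  λ { (suc (suc (suc h))) (s≤s (s≤s (s≤s _))) _ →
        trans (weightCount-family (suc k) (3 + h)) (weightCount-rest-≥3 (suc k) h) }
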